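{- Suppose $\alpha,\beta\in\mathbb{N}_0^N$ satisfy $\alpha\vartriangleright\beta$, and there are integers $m,n$ such that $\dfrac{(r(\beta,i)-r(\alpha,i))\kappa+\alpha_i-\beta_i}{m\kappa+n}\in\mathbb{Q}$ (as elements of the field $\mathbb{Q}(\kappa)$, $\kappa$ an indeterminate) for $1\le i\le N$. Then $mn\ge0$ and $n\ne0$.
   Context: $\mathbb{N}_0=\{0,1,2,\ldots\}$; elements of $\mathbb{N}_0^N$ are compositions, $|\alpha|=\sum_i\alpha_i$. The rank function is $r(\alpha,i)=\#\{j:\alpha_j>\alpha_i\}+\#\{j:1\le j\le i,\ \alpha_j=\alpha_i\}$. For $\alpha\in\mathbb{N}_0^N$, $\alpha^+$ is the unique weakly decreasing rearrangement of $\alpha$. $\alpha\succ\beta$ means $\alpha\ne\beta$ and $\sum_{i=1}^j\alpha_i\ge\sum_{i=1}^j\beta_i$ for all $1\le j\le N$; $\alpha\vartriangleright\beta$ means $|\alpha|=|\beta|$ and either $\alpha^+\succ\beta^+$, or $\alpha^+=\beta^+$ and $\alpha\succ\beta$. -}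

module Defs where

open import Data.Nat as ℕ using (ℕ; _≤_; _<_; _≡ᵇ_; _<ᵇ_; _≤ᵇ_)
open import Data.Nat.Properties using (≤-decTotalOrder)
open import Data.Fin using (Fin; toℕ)
open import Data.Bool using (Bool; true; false; _∧_)
open import Data.List as List using (List; filter; length; take; reverse)
open import Data.Nat.ListAction using (sum)
open import Data.List using (allFin)
open import Data.Vec as Vec using (Vec; lookup; toList)
open import Data.Integer as ℤ using (ℤ)
open import Data.Rational as ℚ using (ℚ)
open import Data.Product using (_×_; ∃)
open import Relation.Binary.PropositionalEquality using (_≡_)
open import Relation.Nullary using (¬_)
open import Relation.Nullary.Decidable using (T?)
import Data.List.Sort as Sort

Comp : ℕ → Set
Comp N = Vec ℕ N

countB : {N : ℕ} → (Fin N → Bool) → ℕ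
countB {N} p = length (filter (λ j → T? (p j)) (allFin N))

rank : {N : ℕ} → Comp N → Fin N → ℕ
rank α i =
  countB (λ j → lookup α i <ᵇ lookup α j)
  ℕ.+ countB (λ j → (toℕ j ≤ᵇ toℕ i) ∧ (lookup α j ≡ᵇ lookup α i))

size : {N : ℕ} → Comp N → ℕ
size α = sum (toList α)

plus : {N : ℕ} → Comp N → List ℕ
plus α = reverse (Sort.sort ≤-decTotalOrder (toList α))

_≻ₗ_ : List ℕ → List ℕ → Set
xs ≻ₗ ys = ¬ (xs ≡ ys) × ((j : ℕ) → sum (take j ys) ≤ sum (take j xs))

_≻_ : {N : ℕ} → Comp N → Comp N → Set
α ≻ β = toList α ≻ₗ toList β

data _⊳_ {N : ℕ} (α β : Comp N) : Set where
  by-plus : size α ≡ size β → plus α ≻ₗ plus β → α ⊳ β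
  by-same : size α ≡ size β → plus α ≡ plus β → α ≻ β → α ⊳ β

ι : ℤ → ℚ
ι z = z ℚ./ 1

-- The element (a κ + b)/(m κ + n) of ℚ(κ) lies in ℚ, where m κ + n ≠ 0:
-- there is q ∈ ℚ with a κ + b = q (m κ + n) as polynomials in κ.
InQ : (a b m n : ℤ) → Set
InQ a b m n = ∃ λ (q : ℚ) → (ι a ≡ q ℚ.* ι m) × (ι b ≡ q ℚ.* ι n)

{-# OPTIONS --safe #-}
-- The hypothesis says r(β,i) − r(α,i) = q_i m and α_i − β_i = q_i n with q_i rational.  For n = 0
-- this forces α = β, which α ⊳ β excludes.  For m n < 0, cross-multiplying shows that α_i − β_i
-- and r(α,i) − r(β,i) have the same sign at every i, although the rank decreases as the entry grows.
-- If α⁺ = β⁺, then α and β have equally many entries above every value, so any α_i ≠ β_i would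
-- order the two ranks the other way; hence α = β.  Otherwise take the first entry v where α⁺
-- exceeds β⁺: α and β have equally many entries above v, and α has more entries equal to v.  The
-- copy of v in α whose rank is 1 + #{j : β_j ≥ v} cannot be matched by β_i, whether β_i is
-- below, equal to or above v.
module Submission where

open import Defs
open import Data.Nat using (ℕ)
open import Data.Fin using (Fin)
open import Data.Vec using (lookup)
open import Data.Integer using (ℤ; _*_; _≤_; _-_; +_; 0ℤ)
open import Data.Product using (_×_)
open import Relation.Binary.PropositionalEquality using (_≡_)
open import Relation.Nullary using (¬_)

open import Level using (Level)
open import Function using (_∘_; flip; Equivalence)
open import Data.Empty using (⊥; ⊥-elim)
open import Data.Unit using (tt)
import Data.Sum as Sum
open import Data.Sum using (inj₁; inj₂)
open import Data.Product using (∃; _,_; proj₂)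
open import Data.Bool using (Bool; true; false; T; _∧_)
open import Data.Bool.Properties using (T-∧)
import Data.Nat as ℕ
open import Data.Nat using (zero; suc; _<ᵇ_; _≤ᵇ_; _≡ᵇ_)
import Data.Nat.Properties as ℕₚ
open import Data.Fin using (toℕ; zero; suc)
open import Data.List using (List; []; _∷_; [_]; _++_; length; filter; map; reverse; allFin; tabulate)
open import Data.List.Properties
  using ( length-++; filter-++; filter-accept; filter-reject; filter-none; filter-some
        ; map-tabulate; unfold-reverse)
open import Data.List.Membership.Propositional using (_∈_; lose)
open import Data.List.Membership.Propositional.Properties using (∈-allFin)
open import Data.List.Relation.Unary.Any using (here)
open import Data.List.Relation.Unary.All as All using (All; []; _∷_)
open import Data.List.Relation.Unary.AllPairs using (AllPairs; []; _∷_)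
import Data.List.Relation.Unary.AllPairs.Properties as AllPairsₚ
open import Data.List.Relation.Unary.Linked.Properties using (Linked⇒AllPairs)
open import Data.List.Relation.Binary.Permutation.Propositional using (_↭_; ↭-sym; ↭-trans)
open import Data.List.Relation.Binary.Permutation.Propositional.Properties
  using (↭-length; filter-↭; ↭-reverse; All-resp-↭)
open import Data.List.Sort ℕₚ.≤-decTotalOrder using (sort-↭; sort-↗)
open import Data.Vec using (Vec; []; _∷_; toList)
open import Data.Vec.Properties using (length-toList; tabulate∘lookup; tabulate-cong)
import Data.Integer as ℤ
open import Data.Integer using (+0; +[1+_]; -[1+_]; -_)
import Data.Integer.Properties as ℤₚ
open import Data.Integer.Tactic.RingSolver using (solve-∀)
import Data.Rational as ℚ
import Data.Rational.Properties as ℚₚ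
import Data.Rational.Unnormalised as ℚᵘ
import Data.Rational.Unnormalised.Properties as ℚᵘₚ
open import Relation.Binary.Core using (Rel)
open import Relation.Binary.Definitions using (tri<; tri≈; tri>)
open import Relation.Binary.PropositionalEquality
  using (refl; sym; trans; cong; cong₂; subst; subst₂; module ≡-Reasoning)
open import Relation.Nullary using (yes; no)
open import Relation.Nullary.Decidable using (T?)

private
  variable
    a ℓ : Level
    A B : Set a
    x : A
    xs ys : List A
    n c v w w′ : ℕ

count : (A → Bool) → List A → ℕ
count p xs = length (filter (λ x → T? (p x)) xs)

count-++ : (p : A → Bool) (xs ys : List A) → count p (xs ++ ys) ≡ count p xs ℕ.+ count p ys
count-++ p xs ys = trans (cong length (filter-++ (T? ∘ p) xs ys)) (length-++ (filter (T? ∘ p) xs))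

count-∷ : (p : A → Bool) (x : A) (xs : List A) → count p (x ∷ xs) ≡ count p [ x ] ℕ.+ count p xs
count-∷ p x = count-++ p [ x ]

count-[x]≡1 : (p : A → Bool) → T (p x) → count p [ x ] ≡ 1
count-[x]≡1 p px = cong length (filter-accept (T? ∘ p) px)

count-[x]≡0 : (p : A → Bool) → ¬ T (p x) → count p [ x ] ≡ 0
count-[x]≡0 p ¬px = cong length (filter-reject (T? ∘ p) ¬px)

count-none : (p : A → Bool) → All (λ x → ¬ T (p x)) xs → count p xs ≡ 0
count-none p none = cong length (filter-none (T? ∘ p) none)

count-pos : (p : A → Bool) → x ∈ xs → T (p x) → 0 ℕ.< count p xs
count-pos p x∈xs px = filter-some (T? ∘ p) (lose x∈xs px)

count-map : (p : B → Bool) (f : A → B) (xs : List A) → count p (map f xs) ≡ count (p ∘ f) xs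
count-map p f [] = refl
count-map p f (x ∷ xs) with p (f x)
... | true  = cong suc (count-map p f xs)
... | false = count-map p f xs

count-↭ : (p : A → Bool) → xs ↭ ys → count p xs ≡ count p ys
count-↭ p xs↭ys = ↭-length (filter-↭ (T? ∘ p) xs↭ys)

count-mono : {p q : A → Bool} → (∀ x → T (p x) → T (q x)) → (xs : List A) → count p xs ℕ.≤ count q xs
count-mono p⇒q [] = ℕ.z≤n
count-mono {p = p} {q} p⇒q (x ∷ xs) with p x | q x | p⇒q x
... | true  | true  | _      = ℕ.s≤s (count-mono p⇒q xs)
... | true  | false | px⇒qx = ⊥-elim (px⇒qx tt)
... | false | true  | _      = ℕₚ.m≤n⇒m≤1+n (count-mono p⇒q xs)
... | false | false | _      = count-mono p⇒q xs

count-cong : (p q : A → Bool) → All (λ x → p x ≡ q x) xs → count p xs ≡ count q xs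
count-cong p q [] = refl
count-cong {xs = x ∷ _} p q (px≡qx ∷ p≗q) with p x | q x | px≡qx
... | true  | .true  | refl = cong suc (count-cong p q p≗q)
... | false | .false | refl = count-cong p q p≗q

count-disjoint-+-≤ : {p q r : A → Bool} → (∀ x → T (p x) → T (q x) → ⊥) →
                     (∀ x → T (p x) → T (r x)) → (∀ x → T (q x) → T (r x)) →
                     (xs : List A) → count p xs ℕ.+ count q xs ℕ.≤ count r xs
count-disjoint-+-≤ _ _ _ [] = ℕ.z≤n
count-disjoint-+-≤ {p = p} {q} {r} disjoint p⇒r q⇒r (x ∷ xs)
  with p x | q x | r x | disjoint x | p⇒r x | q⇒r x | count-disjoint-+-≤ disjoint p⇒r q⇒r xs
... | true  | true  | _     | px∧qx | _ | _ | _ = ⊥-elim (px∧qx tt tt)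
... | true  | false | false | _ | px⇒rx | _ | _ = ⊥-elim (px⇒rx tt)
... | false | true  | false | _ | _ | qx⇒rx | _ = ⊥-elim (qx⇒rx tt)
... | true  | false | true  | _ | _ | _ | ih = ℕ.s≤s ih
... | false | true  | true  | _ | _ | _ | ih =
  subst (ℕ._≤ suc (count r xs)) (sym (ℕₚ.+-suc (count p xs) (count q xs))) (ℕ.s≤s ih)
... | false | false | true  | _ | _ | _ | ih = ℕₚ.m≤n⇒m≤1+n ih
... | false | false | false | _ | _ | _ | ih = ih

countUpTo : (Fin n → Bool) → Fin n → ℕ
countUpTo q i = countB (λ j → (toℕ j ≤ᵇ toℕ i) ∧ q j)

≤ᵇ-suc : ∀ a b → (suc a ≤ᵇ suc b) ≡ (a ≤ᵇ b)
≤ᵇ-suc zero    b = refl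
≤ᵇ-suc (suc a) b = refl

countB-suc : (q : Fin (suc n) → Bool) → countB q ≡ count q [ zero ] ℕ.+ countB (q ∘ suc)
countB-suc {n} q = trans (count-∷ q zero (tabulate suc))
  (cong (count q [ zero ] ℕ.+_) (trans (cong (count q) (sym (map-tabulate (λ j → j) suc)))
                                        (count-map q suc (allFin n))))

countUpTo-zero : (q : Fin (suc n) → Bool) → countUpTo q zero ≡ count q [ zero ]
countUpTo-zero {n} q = begin
  countUpTo q zero                                 ≡⟨ countB-suc upTo₀ ⟩
  count upTo₀ [ zero ] ℕ.+ count (λ _ → false) (allFin n)
    ≡⟨ cong₂ ℕ._+_ (count-cong upTo₀ q (refl ∷ []))
                   (count-none (λ _ → false) (All.universal (λ _ ()) (allFin n))) ⟩
  count q [ zero ] ℕ.+ 0                           ≡⟨ ℕₚ.+-identityʳ _ ⟩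
  count q [ zero ]                                 ∎
  where
  open ≡-Reasoning
  upTo₀ = λ j → (toℕ j ≤ᵇ 0) ∧ q j

countUpTo-suc : (q : Fin (suc n) → Bool) (i : Fin n) →
                countUpTo q (suc i) ≡ count q [ zero ] ℕ.+ countUpTo (q ∘ suc) i
countUpTo-suc {n} q i = begin
  countUpTo q (suc i)                        ≡⟨ countB-suc upTo ⟩
  count upTo [ zero ] ℕ.+ countB (upTo ∘ suc)
    ≡⟨ cong₂ ℕ._+_ (count-cong upTo q (refl ∷ []))
                   (count-cong (upTo ∘ suc) upTo′ (All.universal shift (allFin n))) ⟩
  count q [ zero ] ℕ.+ countUpTo (q ∘ suc) i ∎
  where
  open ≡-Reasoning
  upTo = λ j → (toℕ j ≤ᵇ toℕ (suc i)) ∧ q j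
  upTo′ = λ j → (toℕ j ≤ᵇ toℕ i) ∧ q (suc j)
  shift : ∀ j → upTo (suc j) ≡ upTo′ j
  shift j = cong (_∧ q (suc j)) (≤ᵇ-suc (toℕ j) (toℕ i))

countUpTo-pos : (q : Fin n → Bool) (i : Fin n) → T (q i) → 0 ℕ.< countUpTo q i
countUpTo-pos q i qi = count-pos (λ j → (toℕ j ≤ᵇ toℕ i) ∧ q j) (∈-allFin i)
  (Equivalence.from T-∧ (ℕₚ.≤⇒≤ᵇ (ℕₚ.≤-refl {toℕ i}) , qi))

countUpTo≤countB : (q : Fin n → Bool) (i : Fin n) → countUpTo q i ℕ.≤ countB q
countUpTo≤countB {n} q i =
  count-mono {p = λ j → (toℕ j ≤ᵇ toℕ i) ∧ q j} {q} (λ j → proj₂ ∘ Equivalence.to T-∧) (allFin n)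

select : (q : Fin n → Bool) → c ℕ.< countB q → ∃ λ i → T (q i) × countUpTo q i ≡ suc c
select {suc n} q c<#q with T? (q zero)
select {suc n} {zero} q _ | yes q₀ = zero , q₀ , trans (countUpTo-zero q) (count-[x]≡1 q q₀)
select {suc n} {suc c} q c<#q | yes q₀ =
  let i , qi , #≡ = select (q ∘ suc) (ℕₚ.≤-pred (subst (suc c ℕ.<_) #q≡ c<#q))
  in suc i , qi , trans (countUpTo-suc q i) (cong₂ ℕ._+_ (count-[x]≡1 q q₀) #≡)
  where
  #q≡ : countB q ≡ suc (countB (q ∘ suc))
  #q≡ = trans (countB-suc q) (cong (ℕ._+ countB (q ∘ suc)) (count-[x]≡1 q q₀))
select {suc n} {c} q c<#q | no ¬q₀ =
  let i , qi , #≡ = select (q ∘ suc) (subst (c ℕ.<_) #q≡ c<#q)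
  in suc i , qi , trans (countUpTo-suc q i) (cong₂ ℕ._+_ (count-[x]≡0 q ¬q₀) #≡)
  where
  #q≡ : countB q ≡ countB (q ∘ suc)
  #q≡ = trans (countB-suc q) (cong (ℕ._+ countB (q ∘ suc)) (count-[x]≡0 q ¬q₀))

AllPairs-reverse : {R : Rel A ℓ} → AllPairs R xs → AllPairs (flip R) (reverse xs)
AllPairs-reverse [] = []
AllPairs-reverse {xs = x ∷ xs} (Rx ∷ Rxs) rewrite unfold-reverse x xs =
  AllPairsₚ.++⁺ (AllPairs-reverse Rxs) ([] ∷ [])
    (All.map (_∷ []) (All-resp-↭ (↭-sym (↭-reverse xs)) Rx))

count-above-none : All (ℕ._≤ v) xs → count (v <ᵇ_) xs ≡ 0
count-above-none {v} = count-none (v <ᵇ_) ∘ All.map (λ {z} z≤v → ℕₚ.≤⇒≯ z≤v ∘ ℕₚ.<ᵇ⇒< v z)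

count-equal-none : All (ℕ._< v) xs → count (_≡ᵇ v) xs ≡ 0
count-equal-none {v} = count-none (_≡ᵇ v) ∘ All.map (λ {z} z<v → ℕₚ.<⇒≢ z<v ∘ ℕₚ.≡ᵇ⇒≡ z v)

first-excess : (xs ys : List ℕ) → AllPairs ℕ._≥_ xs → AllPairs ℕ._≥_ ys →
               length xs ≡ length ys → xs ≻ₗ ys →
               ∃ λ v → count (v <ᵇ_) xs ≡ count (v <ᵇ_) ys × count (_≡ᵇ v) ys ℕ.< count (_≡ᵇ v) xs
first-excess [] [] _ _ _ (xs≢ys , _) = ⊥-elim (xs≢ys refl)
first-excess (x ∷ xs) (y ∷ ys) (x≥xs ∷ xs↓) (y≥ys ∷ ys↓) len (x∷xs≢y∷ys , sums≤)
  with x ℕₚ.≟ y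
... | yes refl =
  let v , above≡ , equal< = first-excess xs ys xs↓ ys↓ (ℕₚ.suc-injective len)
                              (x∷xs≢y∷ys ∘ cong (x ∷_) , λ j → ℕₚ.+-cancelˡ-≤ x _ _ (sums≤ (suc j)))
  in v
   , trans (count-∷ (v <ᵇ_) x xs)
       (trans (cong (count (v <ᵇ_) [ x ] ℕ.+_) above≡) (sym (count-∷ (v <ᵇ_) x ys)))
   , subst₂ ℕ._<_ (sym (count-∷ (_≡ᵇ v) x ys)) (sym (count-∷ (_≡ᵇ v) x xs))
       (ℕₚ.+-monoʳ-< (count (_≡ᵇ v) [ x ]) equal<)
... | no x≢y =
  x , trans (count-above-none (ℕₚ.≤-refl ∷ x≥xs)) (sym (count-above-none (All.map ℕₚ.<⇒≤ y∷ys<x)))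
    , subst (ℕ._< count (_≡ᵇ x) (x ∷ xs)) (sym (count-equal-none y∷ys<x))
        (count-pos {xs = x ∷ xs} (_≡ᵇ x) (here refl) (ℕₚ.≡⇒≡ᵇ x x refl))
  where
  y<x : y ℕ.< x
  y<x = ℕₚ.≤∧≢⇒< (subst₂ ℕ._≤_ (ℕₚ.+-identityʳ y) (ℕₚ.+-identityʳ x) (sums≤ 1)) (x≢y ∘ sym)
  y∷ys<x : All (ℕ._< x) (y ∷ ys)
  y∷ys<x = y<x ∷ All.map (λ z≤y → ℕₚ.≤-<-trans z≤y y<x) y≥ys

plus-↭ : (α : Comp n) → plus α ↭ toList α
plus-↭ α = ↭-trans (↭-reverse _) (sort-↭ (toList α))

length-plus : (α : Comp n) → length (plus α) ≡ n
length-plus α = trans (↭-length (plus-↭ α)) (length-toList α)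

plus-descending : (α : Comp n) → AllPairs ℕ._≥_ (plus α)
plus-descending α = AllPairs-reverse (Linked⇒AllPairs ℕₚ.≤-trans (sort-↗ (toList α)))

toList≡tabulate-lookup : (α : Vec A n) → toList α ≡ tabulate (lookup α)
toList≡tabulate-lookup []      = refl
toList≡tabulate-lookup (x ∷ α) = cong (x ∷_) (toList≡tabulate-lookup α)

count-plus : (p : ℕ → Bool) (α : Comp n) → count p (plus α) ≡ countB (λ j → p (lookup α j))
count-plus {n} p α = begin
  count p (plus α)                      ≡⟨ count-↭ p (plus-↭ α) ⟩
  count p (toList α)                    ≡⟨ cong (count p) (toList≡tabulate-lookup α) ⟩
  count p (tabulate (lookup α))         ≡⟨ cong (count p) (map-tabulate (λ j → j) (lookup α)) ⟨
  count p (map (lookup α) (allFin n))   ≡⟨ count-map p (lookup α) (allFin n) ⟩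
  countB (λ j → p (lookup α j))         ∎
  where open ≡-Reasoning

countAbove : Comp n → ℕ → ℕ
countAbove α w = countB (λ j → w <ᵇ lookup α j)

multiplicity : Comp n → ℕ → ℕ
multiplicity α w = countB (λ j → lookup α j ≡ᵇ w)

countAtLeast : Comp n → ℕ → ℕ
countAtLeast α w = countAbove α w ℕ.+ multiplicity α w

plus-first-excess : (α β : Comp n) → plus α ≻ₗ plus β →
               ∃ λ v → countAbove α v ≡ countAbove β v × multiplicity β v ℕ.< multiplicity α v
plus-first-excess α β α⁺≻β⁺
  with first-excess (plus α) (plus β) (plus-descending α) (plus-descending β)
                    (trans (length-plus α) (sym (length-plus β))) α⁺≻β⁺
... | v , above≡ , equal< =
  v , trans (sym (count-plus (v <ᵇ_) α)) (trans above≡ (count-plus (v <ᵇ_) β))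
    , subst₂ ℕ._<_ (count-plus (_≡ᵇ v) β) (count-plus (_≡ᵇ v) α) equal<

countAbove<rank : (α : Comp n) (i : Fin n) → countAbove α (lookup α i) ℕ.< rank α i
countAbove<rank α i = ℕₚ.m<m+n (countAbove α (lookup α i))
  (countUpTo-pos (λ j → lookup α j ≡ᵇ lookup α i) i (ℕₚ.≡⇒≡ᵇ (lookup α i) (lookup α i) refl))

rank≤countAtLeast : (α : Comp n) (i : Fin n) → rank α i ℕ.≤ countAtLeast α (lookup α i)
rank≤countAtLeast α i = ℕₚ.+-monoʳ-≤ (countAbove α (lookup α i))
  (countUpTo≤countB (λ j → lookup α j ≡ᵇ lookup α i) i)

countAtLeast≤countAbove : (α : Comp n) → w ℕ.< w′ → countAtLeast α w′ ℕ.≤ countAbove α w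
countAtLeast≤countAbove {w = w} {w′} α w<w′ =
  count-disjoint-+-≤ disjoint (above⇒above ∘ lookup α) (equal⇒above ∘ lookup α) (allFin _)
  where
  disjoint : ∀ j → T (w′ <ᵇ lookup α j) → T (lookup α j ≡ᵇ w′) → ⊥
  disjoint j w′<αj αj≡w′ = ℕₚ.<⇒≢ (ℕₚ.<ᵇ⇒< w′ (lookup α j) w′<αj) (sym (ℕₚ.≡ᵇ⇒≡ (lookup α j) w′ αj≡w′))
  above⇒above : ∀ z → T (w′ <ᵇ z) → T (w <ᵇ z)
  above⇒above z w′<z = ℕₚ.<⇒<ᵇ (ℕₚ.<-trans w<w′ (ℕₚ.<ᵇ⇒< w′ z w′<z))
  equal⇒above : ∀ z → T (z ≡ᵇ w′) → T (w <ᵇ z)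
  equal⇒above z z≡w′ = ℕₚ.<⇒<ᵇ (subst (w ℕ.<_) (sym (ℕₚ.≡ᵇ⇒≡ z w′ z≡w′)) w<w′)

countAtLeast<rank : (α : Comp n) (i : Fin n) → lookup α i ℕ.< w → countAtLeast α w ℕ.< rank α i
countAtLeast<rank α i αi<w = ℕₚ.≤-<-trans (countAtLeast≤countAbove α αi<w) (countAbove<rank α i)

rank≤countAbove : (α : Comp n) (i : Fin n) → w ℕ.< lookup α i → rank α i ℕ.≤ countAbove α w
rank≤countAbove α i w<αi = ℕₚ.≤-trans (rank≤countAtLeast α i) (countAtLeast≤countAbove α w<αi)

rank≤countAtLeast-of-≤ : (α : Comp n) (i : Fin n) → w ℕ.≤ lookup α i → rank α i ℕ.≤ countAtLeast α w
rank≤countAtLeast-of-≤ {w = w} α i w≤αi with ℕₚ.m≤n⇒m<n∨m≡n w≤αi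
... | inj₁ w<αi = ℕₚ.≤-trans (rank≤countAbove α i w<αi) (ℕₚ.m≤m+n (countAbove α w) (multiplicity α w))
... | inj₂ refl = rank≤countAtLeast α i

rank-select : (α : Comp n) → c ℕ.< multiplicity α v →
              ∃ λ i → lookup α i ≡ v × rank α i ≡ countAbove α v ℕ.+ suc c
rank-select {v = v} α c<mult with select (λ j → lookup α j ≡ᵇ v) c<mult
... | i , αi≡ᵇv , upTo≡ = i , αi≡v ,
  trans (cong (λ w → countAbove α w ℕ.+ countUpTo (λ j → lookup α j ≡ᵇ w) i) αi≡v)
        (cong (countAbove α v ℕ.+_) upTo≡)
  where
  αi≡v : lookup α i ≡ v
  αi≡v = ℕₚ.≡ᵇ⇒≡ (lookup α i) v αi≡ᵇv

record SameOrder (x y s t : ℕ) : Set where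
  field
    <⇒< : x ℕ.< y → s ℕ.< t
    >⇒> : y ℕ.< x → t ℕ.< s
    ≡⇒≡ : x ≡ y → s ≡ t

  ≤⇒≤ : x ℕ.≤ y → s ℕ.≤ t
  ≤⇒≤ = Sum.[ ℕₚ.<⇒≤ ∘ <⇒< , ℕₚ.≤-reflexive ∘ ≡⇒≡ ] ∘ ℕₚ.m≤n⇒m<n∨m≡n

RanksAgree : Comp n → Comp n → Set
RanksAgree α β = ∀ i → SameOrder (lookup α i) (lookup β i) (rank α i) (rank β i)

≡-from-lookup : {α β : Vec A n} → (∀ i → lookup α i ≡ lookup β i) → α ≡ β
≡-from-lookup {α = α} {β} α≗β =
  trans (sym (tabulate∘lookup α)) (trans (tabulate-cong α≗β) (tabulate∘lookup β))

⊳⇒≢ : {α β : Comp n} → α ⊳ β → ¬ (∀ i → lookup α i ≡ lookup β i)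
⊳⇒≢ (by-plus _ (α⁺≢β⁺ , _)) α≗β = α⁺≢β⁺ (cong plus (≡-from-lookup α≗β))
⊳⇒≢ (by-same _ _ (α≢β , _)) α≗β = α≢β (cong toList (≡-from-lookup α≗β))

rank-reverses-< : (α β : Comp n) (i : Fin n) → (∀ w → countAbove α w ≡ countAbove β w) →
                  lookup α i ℕ.< lookup β i → rank β i ℕ.< rank α i
rank-reverses-< α β i above≡ αi<βi = ℕₚ.≤-<-trans (rank≤countAbove β i αi<βi)
  (subst (ℕ._< rank α i) (above≡ (lookup α i)) (countAbove<rank α i))

RanksAgree⇒≗ : (α β : Comp n) → (∀ w → countAbove α w ≡ countAbove β w) → RanksAgree α β →
               ∀ i → lookup α i ≡ lookup β i
RanksAgree⇒≗ α β above≡ agree i with ℕₚ.<-cmp (lookup α i) (lookup β i)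
... | tri< αi<βi _ _ =
  ⊥-elim (ℕₚ.<-asym (SameOrder.<⇒< (agree i) αi<βi) (rank-reverses-< α β i above≡ αi<βi))
... | tri≈ _ αi≡βi _ = αi≡βi
... | tri> _ _ βi<αi =
  ⊥-elim (ℕₚ.<-asym (SameOrder.>⇒> (agree i) βi<αi) (rank-reverses-< β α i (sym ∘ above≡) βi<αi))

excess-position-disagrees : (α β : Comp n) (i : Fin n) → lookup α i ≡ v →
                            rank α i ≡ suc (countAtLeast β v) →
                            ¬ SameOrder (lookup α i) (lookup β i) (rank α i) (rank β i)
excess-position-disagrees {v = v} α β i αi≡v rank-αi agree with v ℕₚ.≤? lookup β i
... | yes v≤βi = ℕₚ.n≮n (countAtLeast β v) (begin-strict
  countAtLeast β v        <⟨ ℕₚ.n<1+n _ ⟩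
  suc (countAtLeast β v)  ≡⟨ rank-αi ⟨
  rank α i                ≤⟨ SameOrder.≤⇒≤ agree (subst (ℕ._≤ lookup β i) (sym αi≡v) v≤βi) ⟩
  rank β i                ≤⟨ rank≤countAtLeast-of-≤ β i v≤βi ⟩
  countAtLeast β v        ∎)
  where open ℕₚ.≤-Reasoning
... | no v≰βi = ℕₚ.n≮n (rank β i) (begin-strict
  rank β i                <⟨ SameOrder.>⇒> agree (subst (lookup β i ℕ.<_) (sym αi≡v) βi<v) ⟩
  rank α i                ≡⟨ rank-αi ⟩
  suc (countAtLeast β v)  ≤⟨ countAtLeast<rank β i βi<v ⟩
  rank β i                ∎)
  where
  open ℕₚ.≤-Reasoning
  βi<v : lookup β i ℕ.< v
  βi<v = ℕₚ.≰⇒> v≰βi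

¬RanksAgree-at-excess : (α β : Comp n) → countAbove α v ≡ countAbove β v →
                        multiplicity β v ℕ.< multiplicity α v → ¬ RanksAgree α β
¬RanksAgree-at-excess α β above≡ equal< agree =
  let i , αi≡v , rank-αi = rank-select α equal<
  in excess-position-disagrees α β i αi≡v
       (trans rank-αi (trans (cong (ℕ._+ _) above≡) (ℕₚ.+-suc _ _))) (agree i)

⊳⇒¬RanksAgree : (α β : Comp n) → α ⊳ β → ¬ RanksAgree α β
⊳⇒¬RanksAgree α β (by-plus _ α⁺≻β⁺) =
  let v , above≡ , equal< = plus-first-excess α β α⁺≻β⁺ in ¬RanksAgree-at-excess α β above≡ equal<
⊳⇒¬RanksAgree α β α⊳β@(by-same _ α⁺≡β⁺ _) agree = ⊳⇒≢ α⊳β (RanksAgree⇒≗ α β above≡ agree)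
  where
  above≡ : ∀ w → countAbove α w ≡ countAbove β w
  above≡ w =
    trans (sym (count-plus (w <ᵇ_) α)) (trans (cong (count (w <ᵇ_)) α⁺≡β⁺) (count-plus (w <ᵇ_) β))

toℚᵘ-ι : (z : ℤ) → ℚ.toℚᵘ (ι z) ℚᵘ.≃ ℚᵘ.mkℚᵘ z 0
toℚᵘ-ι z = ℚₚ.toℚᵘ-fromℚᵘ (ℚᵘ.mkℚᵘ z 0)

ι-injective : {a b : ℤ} → ι a ≡ ι b → a ≡ b
ι-injective {a} {b} ιa≡ιb
  with ℚᵘₚ.≃-trans (ℚᵘₚ.≃-sym (toℚᵘ-ι a)) (ℚᵘₚ.≃-trans (ℚₚ.toℚᵘ-cong ιa≡ιb) (toℚᵘ-ι b))
... | ℚᵘ.*≡* a*1≡b*1 = trans (sym (ℤₚ.*-identityʳ a)) (trans a*1≡b*1 (ℤₚ.*-identityʳ b))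

ι-* : (a b : ℤ) → ι (a * b) ≡ ι a ℚ.* ι b
ι-* a b = ℚₚ.toℚᵘ-injective (begin
  ℚ.toℚᵘ (ι (a * b))               ≈⟨ toℚᵘ-ι (a * b) ⟩
  ℚᵘ.mkℚᵘ (a * b) 0                 ≈⟨ ℚᵘₚ.*-cong (toℚᵘ-ι a) (toℚᵘ-ι b) ⟨
  ℚ.toℚᵘ (ι a) ℚᵘ.* ℚ.toℚᵘ (ι b)   ≈⟨ ℚₚ.toℚᵘ-homo-* (ι a) (ι b) ⟨
  ℚ.toℚᵘ (ι a ℚ.* ι b)             ∎)
  where open ℚᵘₚ.≃-Reasoning

InQ⇒cross : (a b m n : ℤ) → InQ a b m n → a * n ≡ b * m
InQ⇒cross a b m n (q , ιa≡qm , ιb≡qn) = ι-injective (begin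
  ι (a * n)               ≡⟨ ι-* a n ⟩
  ι a ℚ.* ι n             ≡⟨ cong (ℚ._* ι n) ιa≡qm ⟩
  q ℚ.* ι m ℚ.* ι n       ≡⟨ ℚₚ.*-assoc q (ι m) (ι n) ⟩
  q ℚ.* (ι m ℚ.* ι n)     ≡⟨ cong (q ℚ.*_) (ℚₚ.*-comm (ι m) (ι n)) ⟩
  q ℚ.* (ι n ℚ.* ι m)     ≡⟨ ℚₚ.*-assoc q (ι n) (ι m) ⟨
  q ℚ.* ι n ℚ.* ι m       ≡⟨ cong (ℚ._* ι m) ιb≡qn ⟨
  ι b ℚ.* ι m             ≡⟨ ι-* b m ⟨
  ι (b * m)               ∎)
  where open ≡-Reasoning

InQ-zero : (a b m : ℤ) → InQ a b m 0ℤ → b ≡ 0ℤ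
InQ-zero _ _ _ (q , _ , ιb≡q0) = ι-injective (trans ιb≡q0 (ℚₚ.*-zeroʳ q))

balanced⇒< : {s t x y c d : ℕ} → s ℕ.* suc c ℕ.+ y ℕ.* suc d ≡ t ℕ.* suc c ℕ.+ x ℕ.* suc d →
             x ℕ.< y → s ℕ.< t
balanced⇒< {c = c} {d = d} balanced x<y = ℕₚ.≰⇒> λ t≤s → ℕₚ.<-irrefl (sym balanced)
  (ℕₚ.+-mono-≤-< (ℕₚ.*-monoˡ-≤ (suc c) t≤s) (ℕₚ.*-monoˡ-< (suc d) x<y))

balanced⇒SameOrder : {s t x y c d : ℕ} → s ℕ.* suc c ℕ.+ y ℕ.* suc d ≡ t ℕ.* suc c ℕ.+ x ℕ.* suc d →
                     SameOrder x y s t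
balanced⇒SameOrder {s} {t} {x} {c = c} {d} balanced = record
  { <⇒< = balanced⇒< balanced
  ; >⇒> = balanced⇒< (sym balanced)
  ; ≡⇒≡ = λ { refl → ℕₚ.*-cancelʳ-≡ s t (suc c) (ℕₚ.+-cancelʳ-≡ (x ℕ.* suc d) _ _ balanced) }
  }

cross⇒balanced : (s t x y c d : ℕ) → (+ t - + s) * - + c ≡ (+ x - + y) * + d →
                 s ℕ.* c ℕ.+ y ℕ.* d ≡ t ℕ.* c ℕ.+ x ℕ.* d
cross⇒balanced s t x y c d cross = ℤₚ.+-injective (begin
  + (s ℕ.* c ℕ.+ y ℕ.* d)                           ≡⟨ embed s c y d ⟩
  + s * + c ℤ.+ + y * + d                           ≡⟨ move-left (+ t) (+ s) (+ c) (+ y) (+ d) ⟩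
  + t * + c ℤ.+ (+ t - + s) * - + c ℤ.+ + y * + d   ≡⟨ cong (λ z → + t * + c ℤ.+ z ℤ.+ + y * + d) cross ⟩
  + t * + c ℤ.+ (+ x - + y) * + d ℤ.+ + y * + d     ≡⟨ move-right (+ t) (+ c) (+ x) (+ y) (+ d) ⟩
  + t * + c ℤ.+ + x * + d                           ≡⟨ embed t c x d ⟨
  + (t ℕ.* c ℕ.+ x ℕ.* d)                           ∎)
  where
  open ≡-Reasoning
  embed : ∀ a b e f → + (a ℕ.* b ℕ.+ e ℕ.* f) ≡ + a * + b ℤ.+ + e * + f
  embed a b e f = trans (ℤₚ.pos-+ (a ℕ.* b) (e ℕ.* f)) (cong₂ ℤ._+_ (ℤₚ.pos-* a b) (ℤₚ.pos-* e f))
  move-left : ∀ T S C Y D → S * C ℤ.+ Y * D ≡ T * C ℤ.+ (T - S) * - C ℤ.+ Y * D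
  move-left = solve-∀
  move-right : ∀ T C X Y D → T * C ℤ.+ (X - Y) * D ℤ.+ Y * D ≡ T * C ℤ.+ X * D
  move-right = solve-∀

negate-factors : (a b a′ b′ : ℤ) → a * b ≡ a′ * - b′ → a * - b ≡ a′ * b′
negate-factors a b a′ b′ eq = begin
  a * - b         ≡⟨ ℤₚ.neg-distribʳ-* a b ⟨
  - (a * b)       ≡⟨ cong -_ eq ⟩
  - (a′ * - b′)   ≡⟨ cong -_ (ℤₚ.neg-distribʳ-* a′ b′) ⟨
  - - (a′ * b′)   ≡⟨ ℤₚ.neg-involutive (a′ * b′) ⟩
  a′ * b′         ∎
  where open ≡-Reasoning

cross⇒SameOrder : {s t x y : ℕ} (m n : ℤ) → (+ t - + s) * n ≡ (+ x - + y) * m → m * n ℤ.< 0ℤ →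
                  SameOrder x y s t
cross⇒SameOrder +0 n _ (ℤ.+<+ ())
cross⇒SameOrder m +0 _ m*0<0 = ⊥-elim (ℤₚ.<-irrefl (ℤₚ.*-zeroʳ m) m*0<0)
cross⇒SameOrder +[1+ _ ] +[1+ _ ] _ (ℤ.+<+ ())
cross⇒SameOrder -[1+ _ ] -[1+ _ ] _ (ℤ.+<+ ())
cross⇒SameOrder {s} {t} {x} {y} +[1+ d ] -[1+ c ] cross _ =
  balanced⇒SameOrder (cross⇒balanced s t x y (suc c) (suc d) cross)
cross⇒SameOrder {s} {t} {x} {y} -[1+ d ] +[1+ c ] cross _ =
  balanced⇒SameOrder (cross⇒balanced s t x y (suc c) (suc d)
    (negate-factors (+ t - + s) (+ suc c) (+ x - + y) (+ suc d) cross))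

InQ⇒RanksAgree : {N : ℕ} (α β : Comp N) (m n : ℤ) → m * n ℤ.< 0ℤ →
                 (∀ i → InQ (+ rank β i - + rank α i) (+ lookup α i - + lookup β i) m n) →
                 RanksAgree α β
InQ⇒RanksAgree α β m n mn<0 inQ i = cross⇒SameOrder m n
  (InQ⇒cross (+ rank β i - + rank α i) (+ lookup α i - + lookup β i) m n (inQ i)) mn<0

InQ-zero⇒≗ : {N : ℕ} (α β : Comp N) (m : ℤ) →
             (∀ i → InQ (+ rank β i - + rank α i) (+ lookup α i - + lookup β i) m 0ℤ) →
             ∀ i → lookup α i ≡ lookup β i
InQ-zero⇒≗ α β m inQ i = ℤₚ.+-injective (ℤₚ.i-j≡0⇒i≡j (+ lookup α i) (+ lookup β i)
  (InQ-zero (+ rank β i - + rank α i) (+ lookup α i - + lookup β i) m (inQ i)))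

mainTheorem2 : (N : ℕ) (α β : Comp N) (m n : ℤ) →
    α ⊳ β →
    ¬ ((m ≡ 0ℤ) × (n ≡ 0ℤ)) →
    ((i : Fin N) →
      InQ (+ rank β i - + rank α i) (+ lookup α i - + lookup β i) m n) →
    (0ℤ ≤ m * n) × ¬ (n ≡ 0ℤ)
mainTheorem2 N α β m n α⊳β _ inQ =
    ℤₚ.≮⇒≥ (λ mn<0 → ⊳⇒¬RanksAgree α β α⊳β (InQ⇒RanksAgree α β m n mn<0 inQ))
  , λ { refl → ⊳⇒≢ α⊳β (InQ-zero⇒≗ α β m inQ) }
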